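{- Let $\mathbb{F}_q$ be a finite field, $m$ a positive divisor of $q-1$, $n$ a positive integer, and $f(x)=x^nh\big(x^{\frac{q-1}{m}}\big)\in\mathbb{F}_q[x]$ a polynomial of index $m$ which is $m$-nice over $\mathbb{F}_q$. Let $k$ be a positive integer and $b\in\mathbb{F}_q^*$. If $x\in\mathbb{F}_q$ satisfies $f^{(k)}(x)=b$, then $x^{\frac{q-1}{m}}=\psi_f^{(-k)}\big(b^{\frac{q-1}{m}}\big)$, i.e. $x^{\frac{q-1}{m}}$ is the unique element $\xi\in\mu_m$ with $\psi_f^{(k)}(\xi)=b^{\frac{q-1}{m}}$.
   Context: $f^{(k)}$ and $\psi_f^{(k)}$ denote $k$-fold iterates. $\mu_m$ is the set of $m$-th roots of unity in $\mathbb{F}_q$. A polynomial $f$ with $f(0)=0$ is written uniquely as $f(x)=x^nh(x^{\frac{q-1}{m}})$ with $h(0)\ne0$ and $m\mid q-1$ minimal; $m$ is the index of $f$. Put $\psi_f(x)=x^nh(x)^{\frac{q-1}{m}}$. $f$ is $m$-nice over $\mathbb{F}_q$ if $\psi_f$ restricted to $\mu_m\setminus\psi_f^{ -1}(0)$ is an injective map into $\mu_m$; $\psi_f^{(-k)}(y)$ for $y\in\mu_m$ denotes the preimage of $y$ under $\psi_f^{(k)}$ in $\mu_m$. -}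

module Defs where

open import Data.Nat using (ℕ; zero; suc; _<_; _≤_; _∸_) renaming (_*_ to _*ℕ_)
open import Data.Fin using (Fin)
open import Data.List using (List; []; _∷_; replicate; _++_)
open import Data.Product using (Σ; _×_; ∃-syntax)
open import Function.Bundles using (_↔_)
open import Relation.Binary.PropositionalEquality using (_≡_; _≢_)
open import Algebra.Structures using (IsCommutativeRing)

-- A finite field: a commutative ring (with propositional equality) which is
-- nontrivial, in which every nonzero element is invertible, and whose carrier
-- is in bijection with Fin size (so q = size).
record FiniteField : Set₁ where
  infixl 7 _*_
  infixl 6 _+_
  field
    Carrier : Set
    _+_ _*_ : Carrier → Carrier → Carrier
    -_      : Carrier → Carrier
    0# 1#   : Carrier
    isCommutativeRing : IsCommutativeRing _≡_ _+_ _*_ -_ 0# 1#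
    0≢1     : 0# ≢ 1#
    inverse : ∀ x → x ≢ 0# → Σ Carrier (λ y → x * y ≡ 1#)
    size    : ℕ
    enum    : Carrier ↔ Fin size

iter : {A : Set} → ℕ → (A → A) → A → A
iter zero    g x = x
iter (suc k) g x = g (iter k g x)

module _ (F : FiniteField) where
  open FiniteField F

  pow : Carrier → ℕ → Carrier
  pow x zero    = 1#
  pow x (suc e) = x * pow x e

  -- polynomials in F[x] as coefficient lists, constant term first
  Poly : Set
  Poly = List Carrier

  coeff : Poly → ℕ → Carrier
  coeff []       i       = 0#
  coeff (c ∷ cs) zero    = c
  coeff (c ∷ cs) (suc i) = coeff cs i

  -- equality of polynomials (as formal polynomials, ignoring trailing zeros)
  _≐_ : Poly → Poly → Set
  p ≐ p' = ∀ i → coeff p i ≡ coeff p' i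

  eval : Poly → Carrier → Carrier
  eval []       x = 0#
  eval (c ∷ cs) x = c + x * eval cs x

  -- h(x^d) for d ≥ 1: coefficient h_j placed at degree j*d
  spread : ℕ → Poly → Poly
  spread d []       = []
  spread d (c ∷ cs) = c ∷ (replicate (d ∸ 1) 0# ++ spread d cs)

  xnhxd : ℕ → ℕ → Poly → Poly
  xnhxd n d h = replicate n 0# ++ spread d h

  -- m is the index of f: m ∣ q-1 (q-1 = m*d), f = x^n h(x^((q-1)/m)) with
  -- h(0) ≠ 0, f(0) = 0, and m is minimal among all such representations.
  IsIndex : Poly → ℕ → Set
  IsIndex f m =
    coeff f 0 ≡ 0#
    × (0 < m × ∃[ d ] (m *ℕ d ≡ size ∸ 1 × ∃[ n ] ∃[ h ] (coeff h 0 ≢ 0# × f ≐ xnhxd n d h)))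
    × (∀ m' d' n' h' → 0 < m' → m' *ℕ d' ≡ size ∸ 1 → coeff h' 0 ≢ 0#
         → f ≐ xnhxd n' d' h' → m ≤ m')

  μ : ℕ → Carrier → Set
  μ m x = pow x m ≡ 1#

  ψ : ℕ → ℕ → Poly → Carrier → Carrier
  ψ n d h x = pow x n * pow (eval h x) d

  IsNice : ℕ → ℕ → ℕ → Poly → Set
  IsNice m n d h =
    (∀ x → μ m x → ψ n d h x ≢ 0# → μ m (ψ n d h x))
    × (∀ x y → μ m x → ψ n d h x ≢ 0# → μ m y → ψ n d h y ≢ 0#
         → ψ n d h x ≡ ψ n d h y → x ≡ y)

-- With d = (q-1)/m, the power map x ↦ x^d semi-conjugates f = x^n h(x^d) to ψ_f:
-- f(x)^d = x^(nd) h(x^d)^d = ψ_f(x^d), hence (f^(k)(x))^d = ψ_f^(k)(x^d).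
-- Since f(0) = 0, a point with f^(k)(x) = b ≠ 0 is nonzero, so x^d ∈ μ_m by
-- Fermat's little theorem x^(q-1) = 1, itself proved by comparing the product
-- of all units with the product of their multiples a·u.  Finally ψ_f(0) = 0,
-- so an orbit whose k-th point is nonzero stays in μ_m off ψ_f⁻¹(0), where
-- ψ_f is injective; thus ψ_f^(k) is injective there too.
module Submission where

open import Defs
open import Data.Nat using (ℕ; zero; suc; _<_; _∸_) renaming (_*_ to _*ℕ_)
import Data.Nat.Properties as ℕ
open import Data.Fin as Fin using (Fin; punchIn; punchOut)
open import Data.Fin.Properties using (punchInᵢ≢i; punchOut-cong; punchIn-punchOut; punchOut-punchIn)
open import Data.Fin.Permutation using (Permutation′; permutation)
open import Data.List using ([]; _∷_; replicate; _++_)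
open import Data.Product using (_×_; _,_; proj₁; proj₂)
open import Data.Empty using (⊥-elim)
open import Function.Bundles using (_↔_; Inverse)
open import Algebra.Bundles using (CommutativeSemiring)
open import Algebra.Structures using (IsCommutativeRing)
open import Relation.Binary.PropositionalEquality
  using (_≡_; _≢_; refl; sym; trans; cong; cong₂; module ≡-Reasoning)

iter-semiconj : {A B : Set} (p : A → B) {f : A → A} {g : B → B} →
                (∀ x → p (f x) ≡ g (p x)) → ∀ k x → p (iter k f x) ≡ iter k g (p x)
iter-semiconj p p∘f≡g∘p zero    x = refl
iter-semiconj p {f} {g} p∘f≡g∘p (suc k) x =
  trans (p∘f≡g∘p (iter k f x)) (cong g (iter-semiconj p p∘f≡g∘p k x))

iter-fixedPoint : {A : Set} {g : A → A} {z : A} → g z ≡ z → ∀ k → iter k g z ≡ z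
iter-fixedPoint gz≡z zero    = refl
iter-fixedPoint {g = g} gz≡z (suc k) = trans (cong g (iter-fixedPoint gz≡z k)) gz≡z

module _ {A : Set} (P : A → Set) (g : A → A) {z : A} (gz≡z : g z ≡ z)
         (g-maps : ∀ x → P x → g x ≢ z → P (g x))
         (g-injective : ∀ x y → P x → g x ≢ z → P y → g y ≢ z → g x ≡ g y → x ≡ y)
         where

  private
    iter-suc≢⇒iter≢ : ∀ k {x} → iter (suc k) g x ≢ z → iter k g x ≢ z
    iter-suc≢⇒iter≢ k gᵏ⁺¹x≢z gᵏx≡z = gᵏ⁺¹x≢z (trans (cong g gᵏx≡z) gz≡z)

  iter-maps : ∀ k x → P x → iter k g x ≢ z → P (iter k g x)
  iter-maps zero    x Px _        = Px
  iter-maps (suc k) x Px gᵏ⁺¹x≢z =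
    g-maps _ (iter-maps k x Px (iter-suc≢⇒iter≢ k gᵏ⁺¹x≢z)) gᵏ⁺¹x≢z

  iter-injective : ∀ k x y → P x → P y → iter k g x ≢ z →
                   iter k g x ≡ iter k g y → x ≡ y
  iter-injective zero    x y _  _  _       gᵏx≡gᵏy = gᵏx≡gᵏy
  iter-injective (suc k) x y Px Py gᵏ⁺¹x≢z gᵏ⁺¹x≡gᵏ⁺¹y =
    iter-injective k x y Px Py gᵏx≢z
      (g-injective _ _ (iter-maps k x Px gᵏx≢z) gᵏ⁺¹x≢z
                       (iter-maps k y Py gᵏy≢z) (λ eq → gᵏ⁺¹x≢z (trans gᵏ⁺¹x≡gᵏ⁺¹y eq))
                       gᵏ⁺¹x≡gᵏ⁺¹y)
    where
    gᵏx≢z : iter k g x ≢ z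
    gᵏx≢z = iter-suc≢⇒iter≢ k gᵏ⁺¹x≢z
    gᵏy≢z : iter k g y ≢ z
    gᵏy≢z = iter-suc≢⇒iter≢ k (λ eq → gᵏ⁺¹x≢z (trans gᵏ⁺¹x≡gᵏ⁺¹y eq))

module FiniteFieldProperties (F : FiniteField) where
  open FiniteField F
  open IsCommutativeRing isCommutativeRing
    using (*-comm; *-assoc; *-identityˡ; *-identityʳ; zeroˡ; zeroʳ; +-identityˡ; isCommutativeSemiring)
  open ≡-Reasoning

  commutativeSemiring : CommutativeSemiring _ _
  commutativeSemiring = record { isCommutativeSemiring = isCommutativeSemiring }

  open import Algebra.Properties.CommutativeSemiring.Exp commutativeSemiring
    using (_^_; ^-distrib-*; ^-assocʳ)
  open import Algebra.Properties.CommutativeMonoid.Sum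
    (CommutativeSemiring.*-commutativeMonoid commutativeSemiring)
    using (∑-distrib-+; sum-replicate; sum-permute; sum-cong-≗)
    renaming (sum to product)

  inv : (x : Carrier) → x ≢ 0# → Carrier
  inv x x≢0 = proj₁ (inverse x x≢0)

  module _ {x : Carrier} (x≢0 : x ≢ 0#) where

    inv-inverseʳ : x * inv x x≢0 ≡ 1#
    inv-inverseʳ = proj₂ (inverse x x≢0)

    inv-cancelˡ : ∀ y → inv x x≢0 * (x * y) ≡ y
    inv-cancelˡ y = begin
      inv x x≢0 * (x * y) ≡⟨ sym (*-assoc _ x y) ⟩
      inv x x≢0 * x * y   ≡⟨ cong (_* y) (trans (*-comm _ x) inv-inverseʳ) ⟩
      1# * y              ≡⟨ *-identityˡ y ⟩
      y                   ∎

    inv-cancelʳ : ∀ y → x * (inv x x≢0 * y) ≡ y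
    inv-cancelʳ y = trans (sym (*-assoc x _ y)) (trans (cong (_* y) inv-inverseʳ) (*-identityˡ y))

    inv-nonzero : inv x x≢0 ≢ 0#
    inv-nonzero inv≡0 = 0≢1 (begin
      0#            ≡⟨ sym (zeroʳ x) ⟩
      x * 0#        ≡⟨ cong (x *_) (sym inv≡0) ⟩
      x * inv x x≢0 ≡⟨ inv-inverseʳ ⟩
      1#            ∎)

    *-nonzero : ∀ {y} → y ≢ 0# → x * y ≢ 0#
    *-nonzero {y} y≢0 xy≡0 = y≢0 (begin
      y                   ≡⟨ sym (inv-cancelˡ y) ⟩
      inv x x≢0 * (x * y) ≡⟨ cong (inv x x≢0 *_) xy≡0 ⟩
      inv x x≢0 * 0#      ≡⟨ zeroʳ _ ⟩
      0#                  ∎)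

    *-cancelʳ-≡ : ∀ {a} → a * x ≡ x → a ≡ 1#
    *-cancelʳ-≡ {a} ax≡x = begin
      a                   ≡⟨ sym (*-identityʳ a) ⟩
      a * 1#              ≡⟨ cong (a *_) (sym inv-inverseʳ) ⟩
      a * (x * inv x x≢0) ≡⟨ sym (*-assoc a x _) ⟩
      a * x * inv x x≢0   ≡⟨ cong (_* inv x x≢0) ax≡x ⟩
      x * inv x x≢0       ≡⟨ inv-inverseʳ ⟩
      1#                  ∎

  product-nonzero : ∀ {n} (v : Fin n → Carrier) → (∀ j → v j ≢ 0#) → product v ≢ 0#
  product-nonzero {zero}  v v≢0 1≡0 = 0≢1 (sym 1≡0)
  product-nonzero {suc n} v v≢0 =
    *-nonzero (v≢0 Fin.zero) (product-nonzero (λ j → v (Fin.suc j)) (λ j → v≢0 (Fin.suc j)))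

  module UnitEnumeration {n : ℕ} (e : Carrier ↔ Fin (suc n)) where
    open Inverse e using (to; from; strictlyInverseˡ; strictlyInverseʳ)

    -- the nonzero elements are enumerated by the indices other than that of 0#
    unit : Fin n → Carrier
    unit j = from (punchIn (to 0#) j)

    unit-nonzero : ∀ j → unit j ≢ 0#
    unit-nonzero j unit≡0 =
      punchInᵢ≢i (to 0#) j (trans (sym (strictlyInverseˡ _)) (cong to unit≡0))

    index : (y : Carrier) → y ≢ 0# → Fin n
    index y y≢0 = punchOut {i = to 0#} {j = to y} λ eq →
      y≢0 (trans (sym (strictlyInverseʳ y)) (trans (cong from (sym eq)) (strictlyInverseʳ 0#)))

    unit-index : ∀ y y≢0 → unit (index y y≢0) ≡ y
    unit-index y y≢0 = trans (cong from (punchIn-punchOut _)) (strictlyInverseʳ y)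

    index-unit : ∀ j unit≢0 → index (unit j) unit≢0 ≡ j
    index-unit j _ =
      trans (punchOut-cong (to 0#) (strictlyInverseˡ _)) (punchOut-punchIn (to 0#))

    index-cong : ∀ {y y′} y≢0 y′≢0 → y ≡ y′ → index y y≢0 ≡ index y′ y′≢0
    index-cong _ _ y≡y′ = punchOut-cong (to 0#) (cong to y≡y′)

    scale : (a : Carrier) → a ≢ 0# → Fin n → Fin n
    scale a a≢0 j = index (a * unit j) (*-nonzero a≢0 (unit-nonzero j))

    unit-scale : ∀ a a≢0 j → unit (scale a a≢0 j) ≡ a * unit j
    unit-scale a a≢0 j = unit-index (a * unit j) (*-nonzero a≢0 (unit-nonzero j))

    scale-inverse : ∀ {a a′} a≢0 a′≢0 → (∀ y → a′ * (a * y) ≡ y) →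
                    ∀ j → scale a′ a′≢0 (scale a a≢0 j) ≡ j
    scale-inverse {a} {a′} a≢0 a′≢0 a′a≡1 j = trans
      (index-cong (*-nonzero a′≢0 (unit-nonzero (scale a a≢0 j))) (unit-nonzero j) (trans (cong (a′ *_) (unit-scale a a≢0 j)) (a′a≡1 (unit j))))
      (index-unit j (unit-nonzero j))

    scalePermutation : (a : Carrier) → a ≢ 0# → Permutation′ n
    scalePermutation a a≢0 = permutation (scale a a≢0) (scale a′ a′≢0)
      (scale-inverse a′≢0 a≢0 (inv-cancelʳ a≢0)) (scale-inverse a≢0 a′≢0 (inv-cancelˡ a≢0))
      where
      a′ = inv a a≢0
      a′≢0 = inv-nonzero a≢0

    -- multiplying every unit by a permutes the units
    pow-count≡1 : ∀ a → a ≢ 0# → a ^ n ≡ 1#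
    pow-count≡1 a a≢0 = *-cancelʳ-≡ (product-nonzero unit unit-nonzero) (begin
      a ^ n * product unit                    ≡⟨ cong (_* product unit) (sym (sum-replicate n {a})) ⟩
      product {n} (λ _ → a) * product unit      ≡⟨ sym (∑-distrib-+ {n} (λ _ → a) unit) ⟩
      product (λ j → a * unit j)              ≡⟨ sum-cong-≗ (λ j → sym (unit-scale a a≢0 j)) ⟩
      product (λ j → unit (scale a a≢0 j))    ≡⟨ sym (sum-permute unit (scalePermutation a a≢0)) ⟩
      product unit                            ∎)

    count-nonzero : n ≢ 0
    count-nonzero refl with index 1# (λ 1≡0 → 0≢1 (sym 1≡0))
    ... | ()

  pow≡^ : ∀ x n → pow F x n ≡ x ^ n
  pow≡^ x zero    = refl
  pow≡^ x (suc n) = cong (x *_) (pow≡^ x n)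

  pow-size∸1≡1 : ∀ {x} → x ≢ 0# → pow F x (size ∸ 1) ≡ 1#
  pow-size∸1≡1 {x} x≢0 = trans (pow≡^ x (size ∸ 1)) (fermat enum)
    where
    fermat : ∀ {N} → Carrier ↔ Fin N → x ^ (N ∸ 1) ≡ 1#
    fermat {zero}  e with Inverse.to e 0#
    ... | ()
    fermat {suc n} e = UnitEnumeration.pow-count≡1 e x x≢0

  size∸1≢0 : size ∸ 1 ≢ 0
  size∸1≢0 = count-nonzero enum
    where
    count-nonzero : ∀ {N} → Carrier ↔ Fin N → N ∸ 1 ≢ 0
    count-nonzero {zero}  e with Inverse.to e 0#
    ... | ()
    count-nonzero {suc n} e = UnitEnumeration.count-nonzero e

  pow-distrib-* : ∀ x y n → pow F (x * y) n ≡ pow F x n * pow F y n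
  pow-distrib-* x y n = begin
    pow F (x * y) n         ≡⟨ pow≡^ (x * y) n ⟩
    (x * y) ^ n             ≡⟨ ^-distrib-* x y n ⟩
    x ^ n * y ^ n           ≡⟨ sym (cong₂ _*_ (pow≡^ x n) (pow≡^ y n)) ⟩
    pow F x n * pow F y n   ∎

  pow-assocʳ : ∀ x a b → pow F (pow F x a) b ≡ pow F x (a *ℕ b)
  pow-assocʳ x a b = begin
    pow F (pow F x a) b   ≡⟨ pow≡^ (pow F x a) b ⟩
    pow F x a ^ b         ≡⟨ cong (_^ b) (pow≡^ x a) ⟩
    (x ^ a) ^ b           ≡⟨ ^-assocʳ x a b ⟩
    x ^ (a *ℕ b)          ≡⟨ sym (pow≡^ x (a *ℕ b)) ⟩
    pow F x (a *ℕ b)      ∎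

  pow-comm : ∀ x a b → pow F (pow F x a) b ≡ pow F (pow F x b) a
  pow-comm x a b = trans (pow-assocʳ x a b)
                         (trans (cong (pow F x) (ℕ.*-comm a b)) (sym (pow-assocʳ x b a)))

  pow-nonzero : ∀ {x} n → x ≢ 0# → pow F x n ≢ 0#
  pow-nonzero zero    x≢0 1≡0 = 0≢1 (sym 1≡0)
  pow-nonzero (suc n) x≢0 = *-nonzero x≢0 (pow-nonzero n x≢0)

  pow-zero : ∀ n → pow F 0# (suc n) ≡ 0#
  pow-zero n = zeroˡ _

  μ-pow : ∀ {m d x} → m *ℕ d ≡ size ∸ 1 → x ≢ 0# → μ F m (pow F x d)
  μ-pow {m} {d} {x} md≡q-1 x≢0 = begin
    pow F (pow F x d) m    ≡⟨ pow-assocʳ x d m ⟩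
    pow F x (d *ℕ m)       ≡⟨ cong (pow F x) (trans (ℕ.*-comm d m) md≡q-1) ⟩
    pow F x (size ∸ 1)     ≡⟨ pow-size∸1≡1 x≢0 ⟩
    1#                     ∎

  eval-zeros++ : ∀ n p x → eval F (replicate n 0# ++ p) x ≡ pow F x n * eval F p x
  eval-zeros++ zero    p x = sym (*-identityˡ _)
  eval-zeros++ (suc n) p x = begin
    0# + x * eval F (replicate n 0# ++ p) x ≡⟨ +-identityˡ _ ⟩
    x * eval F (replicate n 0# ++ p) x      ≡⟨ cong (x *_) (eval-zeros++ n p x) ⟩
    x * (pow F x n * eval F p x)            ≡⟨ sym (*-assoc x _ _) ⟩
    x * pow F x n * eval F p x              ∎

  -- spread 0 h is h itself, not h(x^0): the spacing d must be positive
  eval-spread : ∀ d h x → eval F (spread F (suc d) h) x ≡ eval F h (pow F x (suc d))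
  eval-spread d []       x = refl
  eval-spread d (c ∷ cs) x = cong (c +_) (begin
    x * eval F (replicate d 0# ++ spread F (suc d) cs) x ≡⟨ cong (x *_) (eval-zeros++ d _ x) ⟩
    x * (pow F x d * eval F (spread F (suc d) cs) x)     ≡⟨ sym (*-assoc x _ _) ⟩
    x * pow F x d * eval F (spread F (suc d) cs) x       ≡⟨ cong (x * pow F x d *_) (eval-spread d cs x) ⟩
    x * pow F x d * eval F cs (pow F x (suc d))          ∎)

  eval-xnhxd : ∀ n d h x → eval F (xnhxd F n (suc d) h) x ≡ pow F x n * eval F h (pow F x (suc d))
  eval-xnhxd n d h x = trans (eval-zeros++ n _ x) (cong (pow F x n *_) (eval-spread d h x))

  eval-xnhxd-zero : ∀ n d h → eval F (xnhxd F (suc n) (suc d) h) 0# ≡ 0#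
  eval-xnhxd-zero n d h =
    trans (eval-xnhxd (suc n) d h 0#) (trans (cong (_* eval F h (pow F 0# (suc d))) (pow-zero n)) (zeroˡ _))

  ψ-zero : ∀ n d h → ψ F (suc n) d h 0# ≡ 0#
  ψ-zero n d h = trans (cong (_* pow F (eval F h 0#) d) (pow-zero n)) (zeroˡ _)

  pow-eval-xnhxd : ∀ n d h x →
    pow F (eval F (xnhxd F n (suc d) h) x) (suc d) ≡ ψ F n (suc d) h (pow F x (suc d))
  pow-eval-xnhxd n d′ h x = begin
    pow F (eval F (xnhxd F n d h) x) d           ≡⟨ cong (λ y → pow F y d) (eval-xnhxd n d′ h x) ⟩
    pow F (pow F x n * eval F h (pow F x d)) d   ≡⟨ pow-distrib-* _ _ d ⟩
    pow F (pow F x n) d * pow F (eval F h (pow F x d)) d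
      ≡⟨ cong (_* pow F (eval F h (pow F x d)) d) (pow-comm x n d) ⟩
    pow F (pow F x d) n * pow F (eval F h (pow F x d)) d ∎
    where d = suc d′

lemma3p5 : (F : FiniteField) → let open FiniteField F in
    (m d n : ℕ) → 0 < m → m *ℕ d ≡ size ∸ 1 → 0 < n →
    (h : Poly F) → coeff F h 0 ≢ 0# →
    IsIndex F (xnhxd F n d h) m →
    IsNice F m n d h →
    (k : ℕ) → 0 < k → (b : Carrier) → b ≢ 0# →
    (x : Carrier) → iter k (eval F (xnhxd F n d h)) x ≡ b →
    μ F m (pow F x d)
    × iter k (ψ F n d h) (pow F x d) ≡ pow F b d
    × (∀ ξ → μ F m ξ → iter k (ψ F n d h) ξ ≡ pow F b d → ξ ≡ pow F x d)
lemma3p5 F m zero n _ m*0≡q-1 _ _ _ _ _ _ _ _ _ _ _ =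
  ⊥-elim (FiniteFieldProperties.size∸1≢0 F (trans (sym m*0≡q-1) (ℕ.*-zeroʳ m)))
lemma3p5 F m (suc d′) (suc n′) _ md≡q-1 _ h _ _ (ψ-maps , ψ-injective) k _ b b≢0 x fᵏx≡b =
  x^d∈μ , ψᵏx^d≡b^d , unique
  where
  open FiniteField F using (0#)
  open FiniteFieldProperties F
  d = suc d′
  n = suc n′

  x≢0 : x ≢ 0#
  x≢0 refl = b≢0 (trans (sym fᵏx≡b) (iter-fixedPoint (eval-xnhxd-zero n′ d′ h) k))

  x^d∈μ : μ F m (pow F x d)
  x^d∈μ = μ-pow {m} {d} md≡q-1 x≢0

  ψᵏx^d≡b^d : iter k (ψ F n d h) (pow F x d) ≡ pow F b d
  ψᵏx^d≡b^d = trans (sym (iter-semiconj (λ y → pow F y d) (pow-eval-xnhxd n d′ h) k x))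
                    (cong (λ y → pow F y d) fᵏx≡b)

  unique : ∀ ξ → μ F m ξ → iter k (ψ F n d h) ξ ≡ pow F b d → ξ ≡ pow F x d
  unique ξ ξ∈μ ψᵏξ≡b^d =
    iter-injective (μ F m) (ψ F n d h) (ψ-zero n′ d h) ψ-maps ψ-injective k ξ (pow F x d)
      ξ∈μ x^d∈μ (λ ψᵏξ≡0 → pow-nonzero d b≢0 (trans (sym ψᵏξ≡b^d) ψᵏξ≡0))
      (trans ψᵏξ≡b^d (sym ψᵏx^d≡b^d))
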